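{- Let $G$ be a connected $P_5$-free chordal bipartite graph with bipartition $(A,B)$ and $|A|=|B|$. If $c(G-S)\le|S|$ for every non-empty subset $S\subseteq V(G)$, then $G$ has a Hamiltonian cycle.
   Context: Graphs are finite, simple and undirected. A bipartite graph is chordal bipartite if every cycle of length at least six has a chord. $P_5$-free means no induced path on five vertices. For $S\subseteq V(G)$, $c(G-S)$ denotes the number of connected components of the subgraph induced on $V(G)\setminus S$. -}

module Defs where

open import Data.Nat using (ℕ; zero; suc; _+_; _≤_)
open import Data.Fin using (Fin; toℕ)
open import Data.Fin.Subset using (Subset; _∈_; _∉_; ∁; ⊥; ∣_∣; Nonempty)
open import Data.Bool using (Bool; true; false; T)
open import Data.Product using (Σ; _×_; ∃; _,_)
open import Data.Sum using (_⊎_)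
open import Relation.Nullary using (¬_)
open import Relation.Binary.PropositionalEquality using (_≡_; _≢_)
open import Function using (_⇔_)
open import Function.Definitions using (Injective; Surjective)

record Graph (n : ℕ) : Set where
  field
    adj     : Fin n → Fin n → Bool
    adj-sym : ∀ u v → adj u v ≡ adj v u
    irrefl  : ∀ v → adj v v ≡ false

open Graph public

Edge : ∀ {n} → Graph n → Fin n → Fin n → Set
Edge G u v = T (adj G u v)

IsBipartition : ∀ {n} → Graph n → Subset n → Set
IsBipartition {n} G A =
  ∀ (u v : Fin n) → Edge G u v → (u ∈ A → v ∉ A) × (u ∉ A → v ∈ A)

CycAdj : (k : ℕ) → Fin k → Fin k → Set
CycAdj k i j =
  suc (toℕ i) ≡ toℕ j ⊎ suc (toℕ j) ≡ toℕ i
  ⊎ (suc (toℕ i) ≡ k × toℕ j ≡ 0) ⊎ (suc (toℕ j) ≡ k × toℕ i ≡ 0)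

record Cycle {n : ℕ} (G : Graph n) (k : ℕ) : Set where
  field
    len≥3   : 3 ≤ k
    vert    : Fin k → Fin n
    inj     : Injective _≡_ _≡_ vert
    cyc     : ∀ i j → CycAdj k i j → Edge G (vert i) (vert j)

open Cycle public

HasChord : ∀ {n k} {G : Graph n} → Cycle G k → Set
HasChord {k = k} {G} C =
  Σ (Fin k) λ i → Σ (Fin k) λ j →
    i ≢ j × ¬ CycAdj k i j × Edge G (vert C i) (vert C j)

ChordalBipartite : ∀ {n} → Graph n → Set
ChordalBipartite {n} G =
  (Σ (Subset n) λ A → IsBipartition G A) ×
  (∀ k → 6 ≤ k → (C : Cycle G k) → HasChord C)

PathAdj : Fin 5 → Fin 5 → Set
PathAdj i j = suc (toℕ i) ≡ toℕ j ⊎ suc (toℕ j) ≡ toℕ i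

InducedP5 : ∀ {n} → Graph n → (Fin 5 → Fin n) → Set
InducedP5 G p = Injective _≡_ _≡_ p × (∀ i j → Edge G (p i) (p j) ⇔ PathAdj i j)

P5Free : ∀ {n} → Graph n → Set
P5Free {n} G = ¬ (Σ (Fin 5 → Fin n) λ p → InducedP5 G p)

data Reach {n : ℕ} (G : Graph n) (S : Subset n) : Fin n → Fin n → Set where
  here  : ∀ {v} → v ∉ S → Reach G S v v
  there : ∀ {u w v} → u ∉ S → Edge G u w → Reach G S w v → Reach G S u v

Connected : ∀ {n} → Graph n → Set
Connected {n} G = Fin n × (∀ u v → Reach G ⊥ u v)

Outside : ∀ {n} → Subset n → Set
Outside {n} S = Σ (Fin n) λ v → v ∉ S

-- "G - S has exactly k connected components": the components of G - S are
-- in bijection with Fin k, via a surjective labelling of the vertices of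
-- G - S whose fibres are exactly the components.
NumComponents : ∀ {n} → Graph n → Subset n → ℕ → Set
NumComponents {n} G S k =
  Σ (Outside S → Fin k) λ lab →
    Surjective _≡_ _≡_ lab ×
    (∀ (x y : Outside S) → (lab x ≡ lab y) ⇔ Reach G S (Data.Product.proj₁ x) (Data.Product.proj₁ y))

HamiltonianCycle : ∀ {n} → Graph n → Set
HamiltonianCycle {n} G = Cycle G n

-- A connected P₅-free bipartite graph is a chain graph: on each side, a vertex of maximum degree
-- is adjacent to the whole other side (a vertex at distance three from it would create an induced P₅
-- together with a private neighbour of the maximum-degree vertex), and then the neighbourhoods on each
-- side are totally ordered by inclusion. Order A = {α₀, …, α_{m-1}} and B = {β₀, …, β_{m-1}} by
-- decreasing degree. If α_j ≁ β_t with j, t ≥ 1 and j + t ≤ m, removing S = {β₀, …, β_{t-1}} isolates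
-- α_j, …, α_{m-1} and leaves α₀ in another component, so G - S has at least m - j + 1 > |S|
-- components, contradicting the toughness hypothesis. Hence α_j ~ β_t whenever j + t ≤ m, and
-- α₀ β_{m-1} α₁ β_{m-2} … α_{m-1} β₀ is a Hamiltonian cycle.
module Submission where

open import Defs
open import Data.Nat using (ℕ; zero; suc; _+_; _∸_; _≤_; _<_; z≤n; s≤s)
import Data.Nat.Properties as ℕ
open import Data.Fin using (Fin; toℕ) renaming (zero to fz; suc to fs)
open import Data.Fin.Properties using (any?; all?; _≟_; injective⇒≤)
import Data.Fin.Properties as Fin
open import Data.Fin.Subset using (Subset; _∈_; _∉_; _⊆_; ∣_∣; ⊥; ⁅_⁆; _∪_; ∁; Nonempty)
open import Data.Fin.Subset.Properties
  using (p⊂q⇒∣p∣<∣q∣; _∈?_; ∣⊥∣≡0; ∣⁅x⁆∣≡1; x∈p∪q⁺; x∈p∪q⁻; x∈⁅x⁆; x∈⁅y⁆⇒x≡y; ∉⊥;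
         x∈p⇒x∉∁p; x∈∁p⇒x∉p; x∉p⇒x∈∁p; x∉∁p⇒x∈p; ∣p∣≤n; ∣∁p∣≡n∸∣p∣)
open import Data.Vec using ([]; _∷_; tabulate)
import Data.Vec as Vec
open import Data.Vec.Properties using (lookup⇒[]=; []=⇒lookup; lookup∘tabulate)
open import Data.List using (List; []; _∷_; length; lookup; filter; allFin; map)
open import Data.List.Properties using (length-map)
import Data.List.Sort
open import Data.List.Membership.Propositional using () renaming (_∈_ to _∈ˡ_)
open import Data.List.Membership.Propositional.Properties
  using (∈-filter⁺; ∈-filter⁻; ∈-allFin; ∈-lookup; ∈-map⁺; ∈-map⁻)
open import Data.List.Membership.Setoid.Properties using (index-injective)
open import Data.List.Relation.Binary.Permutation.Propositional using (_↭_; ↭-sym; ↭⇒↭ₛ)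
open import Data.List.Relation.Binary.Permutation.Propositional.Properties using (∈-resp-↭; ↭-length)
open import Data.List.Relation.Binary.Permutation.Setoid.Properties using (Unique-resp-↭)
import Data.List.Relation.Unary.All as All
import Data.List.Relation.Unary.All.Properties as AllProperties
open import Data.List.Relation.Unary.AllPairs using (AllPairs; []; _∷_)
open import Data.List.Relation.Unary.Any using (here; there; index)
open import Data.List.Relation.Unary.Linked.Properties using (Linked⇒AllPairs)
open import Data.List.Relation.Unary.Unique.Propositional using (Unique)
import Data.List.Relation.Unary.Unique.Propositional.Properties as Unique
open import Data.Bool using (T; true; false)
open import Data.Bool.Properties using (T-≡)
open import Data.Product using (Σ; ∃; _×_; _,_; proj₁; proj₂)
open import Data.Sum using (_⊎_; inj₁; inj₂)
open import Data.Empty using (⊥-elim)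
open import Relation.Nullary using (¬_; Dec; yes; no)
open import Relation.Nullary.Decidable
  using (True; False; toWitness; toWitnessFalse; _×-dec_; _⊎-dec_; _→-dec_; ¬?)
open import Relation.Nullary.Decidable.Core using (T?)
open import Relation.Binary.PropositionalEquality
  using (_≡_; _≢_; refl; sym; trans; subst; subst₂; cong; ≢-sym; setoid)
import Relation.Binary.Construct.On as On
import Relation.Binary.Construct.Flip.Ord as Flip
open import Function using (_⇔_; mk⇔; Equivalence; _∘_)
open import Function.Definitions using (Surjective)

index-lookup : ∀ {A : Set} {xs : List A} → Unique xs → ∀ i (i∈ : lookup xs i ∈ˡ xs) → index i∈ ≡ i
index-lookup (_ ∷ _) fz (here _) = refl
index-lookup (x∉xs ∷ _) fz (there x∈xs) = ⊥-elim (All.lookup x∉xs x∈xs refl)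
index-lookup (x∉xs ∷ _) (fs i) (here eq) = ⊥-elim (All.lookup x∉xs (∈-lookup i) (sym eq))
index-lookup (_ ∷ unique) (fs i) (there i∈) = cong fs (index-lookup unique i i∈)

module _ {A : Set} (default : A) where

  at : List A → ℕ → A
  at [] _ = default
  at (x ∷ _) zero = x
  at (_ ∷ xs) (suc i) = at xs i

  at-∈ : ∀ {xs i} → i < length xs → at xs i ∈ˡ xs
  at-∈ {_ ∷ _} {zero} _ = here refl
  at-∈ {_ ∷ _} {suc i} (s≤s i<) = there (at-∈ i<)

  ∈⇒at : ∀ {x xs} → x ∈ˡ xs → ∃ λ i → i < length xs × at xs i ≡ x
  ∈⇒at (here refl) = zero , s≤s z≤n , refl
  ∈⇒at (there x∈) with ∈⇒at x∈
  ... | i , i< , eq = suc i , s≤s i< , eq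

  at-injective : ∀ {xs i j} → Unique xs → i < length xs → j < length xs → at xs i ≡ at xs j → i ≡ j
  at-injective {_ ∷ _} {zero} {zero} _ _ _ _ = refl
  at-injective {_ ∷ _} {zero} {suc j} (x∉ ∷ _) _ (s≤s j<) eq = ⊥-elim (All.lookup x∉ (at-∈ j<) eq)
  at-injective {_ ∷ _} {suc i} {zero} (x∉ ∷ _) (s≤s i<) _ eq = ⊥-elim (All.lookup x∉ (at-∈ i<) (sym eq))
  at-injective {_ ∷ _} {suc i} {suc j} (_ ∷ u) (s≤s i<) (s≤s j<) eq = cong suc (at-injective u i< j< eq)

  at-monotone : ∀ {R : A → A → Set} → (∀ {x} → R x x) → ∀ {xs i j} → AllPairs R xs
    → i ≤ j → j < length xs → R (at xs i) (at xs j)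
  at-monotone refl′ {_ ∷ _} {zero} {zero} _ _ _ = refl′
  at-monotone _ {_ ∷ _} {zero} {suc j} (x≤ ∷ _) _ (s≤s j<) = All.lookup x≤ (at-∈ j<)
  at-monotone refl′ {_ ∷ _} {suc i} {suc j} (_ ∷ sorted) (s≤s i≤j) (s≤s j<) =
    at-monotone refl′ sorted i≤j j<

elements : ∀ {n} → Subset n → List (Fin n)
elements [] = []
elements (true ∷ p) = fz ∷ map fs (elements p)
elements (false ∷ p) = map fs (elements p)

length-elements : ∀ {n} (p : Subset n) → length (elements p) ≡ ∣ p ∣
length-elements [] = refl
length-elements (true ∷ p) = cong suc (trans (length-map fs (elements p)) (length-elements p))
length-elements (false ∷ p) = trans (length-map fs (elements p)) (length-elements p)

∈-elements⁺ : ∀ {n x} {p : Subset n} → x ∈ p → x ∈ˡ elements p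
∈-elements⁺ {p = true ∷ _} Vec.here = here refl
∈-elements⁺ {p = true ∷ _} (Vec.there x∈) = there (∈-map⁺ fs (∈-elements⁺ x∈))
∈-elements⁺ {p = false ∷ _} (Vec.there x∈) = ∈-map⁺ fs (∈-elements⁺ x∈)

∈-elements⁻ : ∀ {n x} (p : Subset n) → x ∈ˡ elements p → x ∈ p
∈-elements⁻ (true ∷ _) (here refl) = Vec.here
∈-elements⁻ (true ∷ p) (there x∈) with ∈-map⁻ fs x∈
... | _ , y∈ , refl = Vec.there (∈-elements⁻ p y∈)
∈-elements⁻ (false ∷ p) x∈ with ∈-map⁻ fs x∈
... | _ , y∈ , refl = Vec.there (∈-elements⁻ p y∈)

elements-unique : ∀ {n} (p : Subset n) → Unique (elements p)
elements-unique [] = []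
elements-unique (true ∷ p) =
  AllProperties.map⁺ (All.universal (λ _ ()) _) ∷ Unique.map⁺ Fin.suc-injective (elements-unique p)
elements-unique (false ∷ p) = Unique.map⁺ Fin.suc-injective (elements-unique p)

∣p∪q∣≤∣p∣+∣q∣ : ∀ {n} (p q : Subset n) → ∣ p ∪ q ∣ ≤ ∣ p ∣ + ∣ q ∣
∣p∪q∣≤∣p∣+∣q∣ [] [] = z≤n
∣p∪q∣≤∣p∣+∣q∣ (true ∷ p) (true ∷ q) =
  s≤s (ℕ.≤-trans (∣p∪q∣≤∣p∣+∣q∣ p q) (ℕ.+-monoʳ-≤ ∣ p ∣ (ℕ.n≤1+n _)))
∣p∪q∣≤∣p∣+∣q∣ (true ∷ p) (false ∷ q) = s≤s (∣p∪q∣≤∣p∣+∣q∣ p q)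
∣p∪q∣≤∣p∣+∣q∣ (false ∷ p) (true ∷ q) =
  subst (suc ∣ p ∪ q ∣ ≤_) (sym (ℕ.+-suc ∣ p ∣ ∣ q ∣)) (s≤s (∣p∪q∣≤∣p∣+∣q∣ p q))
∣p∪q∣≤∣p∣+∣q∣ (false ∷ p) (false ∷ q) = ∣p∪q∣≤∣p∣+∣q∣ p q

image : ∀ {n} → (ℕ → Fin n) → ℕ → Subset n
image f zero = ⊥
image f (suc t) = ⁅ f t ⁆ ∪ image f t

module _ {n : ℕ} (f : ℕ → Fin n) where

  ∣image∣≤ : ∀ t → ∣ image f t ∣ ≤ t
  ∣image∣≤ zero = ℕ.≤-reflexive (∣⊥∣≡0 n)
  ∣image∣≤ (suc t) = ℕ.≤-trans (∣p∪q∣≤∣p∣+∣q∣ ⁅ f t ⁆ (image f t))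
    (subst (_≤ suc t) (sym (cong (_+ ∣ image f t ∣) (∣⁅x⁆∣≡1 (f t)))) (s≤s (∣image∣≤ t)))

  ∈-image⁺ : ∀ {i t} → i < t → f i ∈ image f t
  ∈-image⁺ {i} {suc t} (s≤s i≤t) with i ℕ.≟ t
  ... | yes refl = x∈p∪q⁺ (inj₁ (x∈⁅x⁆ (f i)))
  ... | no i≢t = x∈p∪q⁺ (inj₂ (∈-image⁺ (ℕ.≤∧≢⇒< i≤t i≢t)))

  ∈-image⁻ : ∀ {x} t → x ∈ image f t → ∃ λ i → i < t × f i ≡ x
  ∈-image⁻ zero x∈ = ⊥-elim (∉⊥ x∈)
  ∈-image⁻ (suc t) x∈ with x∈p∪q⁻ ⁅ f t ⁆ (image f t) x∈
  ... | inj₁ x∈⁅ft⁆ = t , ℕ.≤-refl , sym (x∈⁅y⁆⇒x≡y (f t) x∈⁅ft⁆)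
  ... | inj₂ x∈image with ∈-image⁻ t x∈image
  ...   | i , i<t , eq = i , ℕ.m≤n⇒m≤1+n i<t , eq

double : ℕ → ℕ
double zero = zero
double (suc i) = suc (suc (double i))

data EvenOdd : ℕ → Set where
  even : ∀ i → EvenOdd (double i)
  odd : ∀ i → EvenOdd (suc (double i))

evenOdd : ∀ p → EvenOdd p
evenOdd zero = even zero
evenOdd (suc p) with evenOdd p
... | even i = odd i
... | odd i = even (suc i)

double-cancel-< : ∀ {i m} → double i < double m → i < m
double-cancel-< {zero} {suc m} _ = s≤s z≤n
double-cancel-< {suc i} {suc m} (s≤s (s≤s lt)) = s≤s (double-cancel-< lt)

suc-double-cancel-< : ∀ {i m} → suc (double i) < double m → i < m
suc-double-cancel-< lt = double-cancel-< (ℕ.<⇒≤ lt)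

double≡+ : ∀ m → double m ≡ m + m
double≡+ zero = refl
double≡+ (suc m) = cong suc (trans (cong suc (double≡+ m)) (sym (ℕ.+-suc m m)))

interleave : ∀ {A : Set} → (ℕ → A) → (ℕ → A) → ℕ → A
interleave f g zero = f 0
interleave f g (suc zero) = g 0
interleave f g (suc (suc p)) = interleave (f ∘ suc) (g ∘ suc) p

interleave-even : ∀ {A : Set} (f g : ℕ → A) i → interleave f g (double i) ≡ f i
interleave-even f g zero = refl
interleave-even f g (suc i) = interleave-even (f ∘ suc) (g ∘ suc) i

interleave-odd : ∀ {A : Set} (f g : ℕ → A) i → interleave f g (suc (double i)) ≡ g i
interleave-odd f g zero = refl
interleave-odd f g (suc i) = interleave-odd (f ∘ suc) (g ∘ suc) i

-- Induced paths, neighbourhoods and components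

pathAdj? : ∀ i j → Dec (PathAdj i j)
pathAdj? i j = (suc (toℕ i) ℕ.≟ toℕ j) ⊎-dec (suc (toℕ j) ℕ.≟ toℕ i)

pathAdj-rows-injective : ∀ i j → (∀ k → PathAdj i k → PathAdj j k) → (∀ k → PathAdj j k → PathAdj i k) → i ≡ j
pathAdj-rows-injective = toWitness {a? = all? λ i → all? λ j →
  all? (λ k → pathAdj? i k →-dec pathAdj? j k) →-dec
  all? (λ k → pathAdj? j k →-dec pathAdj? i k) →-dec
  i ≟ j} _

module _ {n : ℕ} (G : Graph n) where

  Edge-sym : ∀ {u v} → Edge G u v → Edge G v u
  Edge-sym {u} {v} = subst T (adj-sym G u v)

  Edge-irrefl : ∀ {v} → ¬ Edge G v v
  Edge-irrefl {v} = subst T (irrefl G v)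

  Edge? : ∀ u v → Dec (Edge G u v)
  Edge? u v = T? (adj G u v)

  mkInducedP5 : ∀ {p₀ p₁ p₂ p₃ p₄}
    → Edge G p₀ p₁ → Edge G p₁ p₂ → Edge G p₂ p₃ → Edge G p₃ p₄
    → ¬ Edge G p₀ p₂ → ¬ Edge G p₀ p₃ → ¬ Edge G p₀ p₄
    → ¬ Edge G p₁ p₃ → ¬ Edge G p₁ p₄
    → ¬ Edge G p₂ p₄
    → Σ (Fin 5 → Fin n) (InducedP5 G)
  mkInducedP5 {p₀} {p₁} {p₂} {p₃} {p₄} e₀₁ e₁₂ e₂₃ e₃₄ n₀₂ n₀₃ n₀₄ n₁₃ n₁₄ n₂₄ =
    p , injective , adjacency
    where
    p : Fin 5 → Fin n
    p fz = p₀
    p (fs fz) = p₁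
    p (fs (fs fz)) = p₂
    p (fs (fs (fs fz))) = p₃
    p (fs (fs (fs (fs fz)))) = p₄

    edge : ∀ {a b i j} → Edge G a b → {True (pathAdj? i j)} → Edge G a b ⇔ PathAdj i j
    edge e {adj} = mk⇔ (λ _ → toWitness adj) (λ _ → e)

    edge˘ : ∀ {a b i j} → Edge G b a → {True (pathAdj? i j)} → Edge G a b ⇔ PathAdj i j
    edge˘ e {adj} = edge (Edge-sym e) {adj}

    nonEdge : ∀ {a b i j} → ¬ Edge G a b → {False (pathAdj? i j)} → Edge G a b ⇔ PathAdj i j
    nonEdge ne {¬adj} = mk⇔ (λ e → ⊥-elim (ne e)) (λ a → ⊥-elim (toWitnessFalse ¬adj a))

    nonEdge˘ : ∀ {a b i j} → ¬ Edge G b a → {False (pathAdj? i j)} → Edge G a b ⇔ PathAdj i j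
    nonEdge˘ ne {¬adj} = nonEdge (λ e → ne (Edge-sym e)) {¬adj}

    adjacency : ∀ i j → Edge G (p i) (p j) ⇔ PathAdj i j
    adjacency fz fz = nonEdge Edge-irrefl
    adjacency fz (fs fz) = edge e₀₁
    adjacency fz (fs (fs fz)) = nonEdge n₀₂
    adjacency fz (fs (fs (fs fz))) = nonEdge n₀₃
    adjacency fz (fs (fs (fs (fs fz)))) = nonEdge n₀₄
    adjacency (fs fz) fz = edge˘ e₀₁
    adjacency (fs fz) (fs fz) = nonEdge Edge-irrefl
    adjacency (fs fz) (fs (fs fz)) = edge e₁₂
    adjacency (fs fz) (fs (fs (fs fz))) = nonEdge n₁₃
    adjacency (fs fz) (fs (fs (fs (fs fz)))) = nonEdge n₁₄
    adjacency (fs (fs fz)) fz = nonEdge˘ n₀₂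
    adjacency (fs (fs fz)) (fs fz) = edge˘ e₁₂
    adjacency (fs (fs fz)) (fs (fs fz)) = nonEdge Edge-irrefl
    adjacency (fs (fs fz)) (fs (fs (fs fz))) = edge e₂₃
    adjacency (fs (fs fz)) (fs (fs (fs (fs fz)))) = nonEdge n₂₄
    adjacency (fs (fs (fs fz))) fz = nonEdge˘ n₀₃
    adjacency (fs (fs (fs fz))) (fs fz) = nonEdge˘ n₁₃
    adjacency (fs (fs (fs fz))) (fs (fs fz)) = edge˘ e₂₃
    adjacency (fs (fs (fs fz))) (fs (fs (fs fz))) = nonEdge Edge-irrefl
    adjacency (fs (fs (fs fz))) (fs (fs (fs (fs fz)))) = edge e₃₄
    adjacency (fs (fs (fs (fs fz)))) fz = nonEdge˘ n₀₄
    adjacency (fs (fs (fs (fs fz)))) (fs fz) = nonEdge˘ n₁₄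
    adjacency (fs (fs (fs (fs fz)))) (fs (fs fz)) = nonEdge˘ n₂₄
    adjacency (fs (fs (fs (fs fz)))) (fs (fs (fs fz))) = edge˘ e₃₄
    adjacency (fs (fs (fs (fs fz)))) (fs (fs (fs (fs fz)))) = nonEdge Edge-irrefl

    -- Equal vertices have equal rows in the adjacency table, and the rows of P₅ are pairwise distinct.
    same-row : ∀ {i j} → p i ≡ p j → ∀ k → PathAdj i k → PathAdj j k
    same-row {i} {j} pi≡pj k a =
      Equivalence.to (adjacency j k) (subst (λ x → Edge G x (p k)) pi≡pj (Equivalence.from (adjacency i k) a))

    injective : ∀ {i j} → p i ≡ p j → i ≡ j
    injective pi≡pj = pathAdj-rows-injective _ _ (same-row pi≡pj) (same-row (sym pi≡pj))

  neighbours : Fin n → Subset n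
  neighbours v = tabulate (adj G v)

  degree : Fin n → ℕ
  degree v = ∣ neighbours v ∣

  Edge⇒∈neighbours : ∀ {v x} → Edge G v x → x ∈ neighbours v
  Edge⇒∈neighbours {v} {x} e =
    lookup⇒[]= x (neighbours v) (trans (lookup∘tabulate (adj G v) x) (Equivalence.to T-≡ e))

  ∈neighbours⇒Edge : ∀ {v x} → x ∈ neighbours v → Edge G v x
  ∈neighbours⇒Edge {v} {x} x∈ =
    Equivalence.from T-≡ (trans (sym (lookup∘tabulate (adj G v) x)) ([]=⇒lookup x∈))

  private-neighbour : ∀ {u u' w} → degree u' ≤ degree u → Edge G u' w → ¬ Edge G u w
    → ∃ λ x → Edge G u x × ¬ Edge G u' x
  private-neighbour {u} {u'} {w} deg≤ u'w ¬uw with any? (λ x → Edge? u x ×-dec ¬? (Edge? u' x))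
  ... | yes found = found
  ... | no none = ⊥-elim (ℕ.<-irrefl refl (ℕ.<-≤-trans deg<deg′ deg≤))
    where
    N[u]⊆N[u'] : neighbours u ⊆ neighbours u'
    N[u]⊆N[u'] {x} x∈ with Edge? u' x
    ... | yes u'x = Edge⇒∈neighbours u'x
    ... | no ¬u'x = ⊥-elim (none (x , ∈neighbours⇒Edge x∈ , ¬u'x))

    deg<deg′ : degree u < degree u'
    deg<deg′ = p⊂q⇒∣p∣<∣q∣ (N[u]⊆N[u'] , w , Edge⇒∈neighbours u'w , ¬uw ∘ ∈neighbours⇒Edge)

  Isolated : Subset n → Fin n → Set
  Isolated S x = ∀ w → Edge G x w → w ∈ S

  module _ {S : Subset n} where

    Reach-start : ∀ {u v} → Reach G S u v → u ∉ S
    Reach-start (here u∉S) = u∉S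
    Reach-start (there u∉S _ _) = u∉S

    Reach-trans : ∀ {u v w} → Reach G S u v → Reach G S v w → Reach G S u w
    Reach-trans (here _) r' = r'
    Reach-trans (there u∉S e r) r' = there u∉S e (Reach-trans r r')

    Reach-sym : ∀ {u v} → Reach G S u v → Reach G S v u
    Reach-sym (here v∉S) = here v∉S
    Reach-sym (there u∉S e r) = Reach-trans (Reach-sym r) (there (Reach-start r) (Edge-sym e) (here u∉S))

    Isolated-Reach : ∀ {x y} → Isolated S x → Reach G S x y → x ≡ y
    Isolated-Reach _ (here _) = refl
    Isolated-Reach iso (there _ e r) = ⊥-elim (Reach-start r (iso _ e))

    Reach-Isolated : ∀ {x y} → Isolated S y → Reach G S x y → x ≡ y
    Reach-Isolated iso r = sym (Isolated-Reach iso (Reach-sym r))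

    numComponents-≥ : ∀ {k r} → NumComponents G S k → (v : Fin r → Outside S)
      → (∀ i j → Reach G S (proj₁ (v i)) (proj₁ (v j)) → i ≡ j) → r ≤ k
    numComponents-≥ (_ , _ , sameLabel⇔Reach) v separated =
      injective⇒≤ λ {i} {j} same → separated i j (Equivalence.to (sameLabel⇔Reach (v i) (v j)) same)

    -- Every vertex of G - S outside the component of the hub is isolated, so the components are
    -- that of the hub together with one singleton per isolated vertex other than the hub.
    module _ {hub : Fin n} (hub∉S : hub ∉ S)
             (reachesHub : ∀ {x w} → x ∉ S → w ∉ S → Edge G x w → Reach G S x hub) where

      open import Data.List.Membership.DecPropositional (_≟_ {n}) using () renaming (_∈?_ to _∈ˡ?_)

      Stray : Fin n → Set
      Stray x = x ∉ S × Isolated S x × x ≢ hub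

      stray? : ∀ x → Dec (Stray x)
      stray? x = ¬? (x ∈? S) ×-dec all? (λ w → Edge? x w →-dec (w ∈? S)) ×-dec ¬? (x ≟ hub)

      strays : List (Fin n)
      strays = filter stray? (allFin n)

      strays-unique : Unique strays
      strays-unique = Unique.filter⁺ stray? (Unique.allFin⁺ n)

      ∈strays⇒Stray : ∀ {x} → x ∈ˡ strays → Stray x
      ∈strays⇒Stray x∈ = proj₂ (∈-filter⁻ stray? {xs = allFin n} x∈)

      Stray⇒∈strays : ∀ {x} → Stray x → x ∈ˡ strays
      Stray⇒∈strays = ∈-filter⁺ stray? (∈-allFin _)

      nonStray⇒Reach-hub : ∀ {x} → x ∉ S → ¬ Stray x → Reach G S x hub
      nonStray⇒Reach-hub {x} x∉S ¬stray with x ≟ hub | any? (λ w → Edge? x w ×-dec ¬? (w ∈? S))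
      ... | yes refl | _ = here x∉S
      ... | no x≢hub | yes (w , e , w∉S) = reachesHub x∉S w∉S e
      ... | no x≢hub | no noEscape = ⊥-elim (¬stray (x∉S , isolated , x≢hub))
        where
        isolated : Isolated S x
        isolated w e with w ∈? S
        ... | yes w∈S = w∈S
        ... | no w∉S = ⊥-elim (noEscape (w , e , w∉S))

      labelOf : Fin n → Fin (suc (length strays))
      labelOf x with x ∈ˡ? strays
      ... | yes x∈ = fs (index x∈)
      ... | no _ = fz

      nonStray-label : ∀ {x} → ¬ Stray x → labelOf x ≡ fz
      nonStray-label {x} ¬stray with x ∈ˡ? strays
      ... | yes x∈ = ⊥-elim (¬stray (∈strays⇒Stray x∈))
      ... | no _ = refl

      label : Outside S → Fin (suc (length strays))
      label (x , _) = labelOf x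

      label-surjective : Surjective _≡_ _≡_ label
      label-surjective fz = (hub , hub∉S) , λ { refl → nonStray-label λ stray → proj₂ (proj₂ stray) refl }
      label-surjective (fs i) =
        (lookup strays i , proj₁ (∈strays⇒Stray (∈-lookup i))) , λ { refl → lookup-label }
        where
        lookup-label : labelOf (lookup strays i) ≡ fs i
        lookup-label with lookup strays i ∈ˡ? strays
        ... | yes i∈ = cong fs (index-lookup strays-unique i i∈)
        ... | no ∉ = ⊥-elim (∉ (∈-lookup i))

      sameLabel⇒Reach : ∀ x y → label x ≡ label y → Reach G S (proj₁ x) (proj₁ y)
      sameLabel⇒Reach (x , x∉S) (y , y∉S) same with x ∈ˡ? strays | y ∈ˡ? strays
      ... | yes x∈ | yes y∈ =
        subst (Reach G S x) (index-injective (setoid (Fin n)) x∈ y∈ (Fin.suc-injective same)) (here x∉S)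
      ... | no x∉ | no y∉ = Reach-trans (nonStray⇒Reach-hub x∉S (x∉ ∘ Stray⇒∈strays))
                                       (Reach-sym (nonStray⇒Reach-hub y∉S (y∉ ∘ Stray⇒∈strays)))
      sameLabel⇒Reach _ _ () | yes _ | no _
      sameLabel⇒Reach _ _ () | no _ | yes _

      Reach⇒sameLabel : ∀ x y → Reach G S (proj₁ x) (proj₁ y) → label x ≡ label y
      Reach⇒sameLabel (x , _) (y , _) r with stray? x | stray? y
      ... | yes (_ , iso , _) | _ = cong labelOf (Isolated-Reach iso r)
      ... | no _ | yes (_ , iso , _) = cong labelOf (Reach-Isolated iso r)
      ... | no ¬sx | no ¬sy = trans (nonStray-label ¬sx) (sym (nonStray-label ¬sy))

      numComponents-hub : ∃ (NumComponents G S)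
      numComponents-hub = suc (length strays) , label , label-surjective ,
        λ x y → mk⇔ (sameLabel⇒Reach x y) (Reach⇒sameLabel x y)

  -- Chain structure of connected P₅-free bipartite graphs

  ∁-IsBipartition : ∀ {X} → IsBipartition G X → IsBipartition G (∁ X)
  ∁-IsBipartition bipartition u v e =
    (λ u∈∁X v∈∁X → x∈∁p⇒x∉p v∈∁X (proj₂ (bipartition u v e) (x∈∁p⇒x∉p u∈∁X))) ,
    (λ u∉∁X → x∉p⇒x∈∁p (proj₁ (bipartition u v e) (x∉∁p⇒x∈p u∉∁X)))

  module ChainStructure {X : Subset n} (bipartition : IsBipartition G X) (p5-free : P5Free G) where

    ∈⇒adjacent∉ : ∀ {u v} → u ∈ X → Edge G u v → v ∉ X
    ∈⇒adjacent∉ {u} {v} u∈X e = proj₁ (bipartition u v e) u∈X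

    ∉⇒adjacent∈ : ∀ {u v} → u ∉ X → Edge G u v → v ∈ X
    ∉⇒adjacent∈ {u} {v} u∉X e = proj₂ (bipartition u v e) u∉X

    ∈-nonadjacent : ∀ {u v} → u ∈ X → v ∈ X → ¬ Edge G u v
    ∈-nonadjacent u∈X v∈X e = ∈⇒adjacent∉ u∈X e v∈X

    ∉-nonadjacent : ∀ {u v} → u ∉ X → v ∉ X → ¬ Edge G u v
    ∉-nonadjacent u∉X v∉X e = v∉X (∉⇒adjacent∈ u∉X e)

    module _ {h : Fin n} (h∈X : h ∈ X) where

      module _ (maximal : ∀ {u} → u ∈ X → degree u ≤ degree h) where

        WithinTwo : Fin n → Set
        WithinTwo v = v ≡ h ⊎ Edge G h v ⊎ (v ∈ X × ∃ λ c → Edge G h c × Edge G c v)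

        -- A vertex u ∈ X at distance two from h (via c) with a neighbour w beyond reach of h would,
        -- by maximality of h, leave h a neighbour y missed by u, and w - u - c - h - y would be an induced P₅.
        WithinTwo-step : ∀ {u w} → WithinTwo u → Edge G u w → WithinTwo w
        WithinTwo-step (inj₁ refl) hw = inj₂ (inj₁ hw)
        WithinTwo-step (inj₂ (inj₁ hu)) uw = inj₂ (inj₂ (∉⇒adjacent∈ (∈⇒adjacent∉ h∈X hu) uw , _ , hu , uw))
        WithinTwo-step {u} {w} (inj₂ (inj₂ (u∈X , c , hc , cu))) uw with Edge? h w
        ... | yes hw = inj₂ (inj₁ hw)
        ... | no ¬hw with private-neighbour (maximal u∈X) uw ¬hw
        ...   | y , hy , ¬uy = ⊥-elim (p5-free (mkInducedP5 (Edge-sym uw) (Edge-sym cu) (Edge-sym hc) hy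
                (∉-nonadjacent w∉X c∉X) (¬hw ∘ Edge-sym) (∉-nonadjacent w∉X y∉X)
                (∈-nonadjacent u∈X h∈X) ¬uy
                (∉-nonadjacent c∉X y∉X)))
          where
          w∉X : w ∉ X
          w∉X = ∈⇒adjacent∉ u∈X uw
          c∉X : c ∉ X
          c∉X = ∈⇒adjacent∉ h∈X hc
          y∉X : y ∉ X
          y∉X = ∈⇒adjacent∉ h∈X hy

        WithinTwo-Reach : ∀ {S u v} → WithinTwo u → Reach G S u v → WithinTwo v
        WithinTwo-Reach near (here _) = near
        WithinTwo-Reach near (there _ e r) = WithinTwo-Reach (WithinTwo-step near e) r

        maxDegree-dominates : (∀ v → Reach G ⊥ h v) → ∀ {w} → w ∉ X → Edge G h w
        maxDegree-dominates connected {w} w∉X with WithinTwo-Reach (inj₁ refl) (connected w)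
        ... | inj₁ refl = ⊥-elim (w∉X h∈X)
        ... | inj₂ (inj₁ hw) = hw
        ... | inj₂ (inj₂ (w∈X , _)) = ⊥-elim (w∉X w∈X)

      dominating⇒nested : (∀ {w} → w ∉ X → Edge G h w) → ∀ {u u' w} → u ∈ X → u' ∈ X
        → degree u' ≤ degree u → Edge G u' w → Edge G u w
      dominating⇒nested dominating {u} {u'} {w} u∈X u'∈X deg≤ u'w with Edge? u w
      ... | yes uw = uw
      ... | no ¬uw with private-neighbour deg≤ u'w ¬uw
      ...   | x , ux , ¬u'x = ⊥-elim (p5-free (mkInducedP5 ux (Edge-sym (dominating x∉X)) (dominating w∉X) (Edge-sym u'w)
              (∈-nonadjacent u∈X h∈X) ¬uw (∈-nonadjacent u∈X u'∈X)
              (∉-nonadjacent x∉X w∉X) (¬u'x ∘ Edge-sym)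
              (∈-nonadjacent h∈X u'∈X)))
        where
        x∉X : x ∉ X
        x∉X = ∈⇒adjacent∉ u∈X ux
        w∉X : w ∉ X
        w∉X = ∈⇒adjacent∉ u'∈X u'w

  -- Only the first m values of vertex matter; beyond them it is arbitrary.
  record DegreeOrdering (X : Subset n) (m : ℕ) : Set where
    field
      vertex : ℕ → Fin n
      vertex-∈ : ∀ {i} → i < m → vertex i ∈ X
      vertex-injective : ∀ {i j} → i < m → j < m → vertex i ≡ vertex j → i ≡ j
      vertex-surjective : ∀ {x} → x ∈ X → ∃ λ i → i < m × vertex i ≡ x
      degree-antitone : ∀ {i j} → i ≤ j → j < m → degree (vertex j) ≤ degree (vertex i)

  module ByDegree = Data.List.Sort (On.decTotalOrder (Flip.decTotalOrder ℕ.≤-decTotalOrder) degree)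

  degreeOrdering : Fin n → (X : Subset n) → DegreeOrdering X ∣ X ∣
  degreeOrdering default X = record
    { vertex = at default sorted
    ; vertex-∈ = λ i< → ∈-elements⁻ X (∈-resp-↭ sorted↭elements (at-∈ default (bound i<)))
    ; vertex-injective = λ i< j< → at-injective default sorted-unique (bound i<) (bound j<)
    ; vertex-surjective = λ x∈ →
        let i , i< , eq = ∈⇒at default (∈-resp-↭ (↭-sym sorted↭elements) (∈-elements⁺ x∈))
        in i , subst (i <_) length-sorted i< , eq
    ; degree-antitone = λ i≤j j< → at-monotone default ℕ.≤-refl sorted-pairwise i≤j (bound j<)
    }
    where
    sorted : List (Fin n)
    sorted = ByDegree.sort (elements X)

    sorted↭elements : sorted ↭ elements X
    sorted↭elements = ByDegree.sort-↭ (elements X)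

    sorted-pairwise : AllPairs (λ x y → degree y ≤ degree x) sorted
    sorted-pairwise = Linked⇒AllPairs (λ xy yz → ℕ.≤-trans yz xy) (ByDegree.sort-↗ (elements X))

    length-sorted : length sorted ≡ ∣ X ∣
    length-sorted = trans (↭-length sorted↭elements) (length-elements X)

    bound : ∀ {i} → i < ∣ X ∣ → i < length sorted
    bound = subst (_ <_) (sym length-sorted)

    sorted-unique : Unique sorted
    sorted-unique = Unique-resp-↭ (setoid (Fin n)) (↭⇒↭ₛ (↭-sym sorted↭elements)) (elements-unique X)

  -- Hamiltonian cycles

  sequence⇒HamiltonianCycle : 3 ≤ n → (c : ℕ → Fin n)
    → (∀ {p q} → p < n → q < n → c p ≡ c q → p ≡ q)
    → (∀ {p} → suc p < n → Edge G (c p) (c (suc p)))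
    → (∀ {p} → suc p ≡ n → Edge G (c p) (c 0))
    → HamiltonianCycle G
  sequence⇒HamiltonianCycle n≥3 c injective step close = record
    { len≥3 = n≥3
    ; vert = c ∘ toℕ
    ; inj = λ eq → Fin.toℕ-injective (injective (Fin.toℕ<n _) (Fin.toℕ<n _) eq)
    ; cyc = cyclic
    }
    where
    forward : ∀ i j → suc (toℕ i) ≡ toℕ j → Edge G (c (toℕ i)) (c (toℕ j))
    forward i j eq = subst (Edge G (c (toℕ i)) ∘ c) eq (step (subst (_< n) (sym eq) (Fin.toℕ<n j)))

    closing : ∀ i j → suc (toℕ i) ≡ n × toℕ j ≡ 0 → Edge G (c (toℕ i)) (c (toℕ j))
    closing i j (last , j≡0) = subst (Edge G (c (toℕ i)) ∘ c) (sym j≡0) (close last)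

    cyclic : ∀ i j → CycAdj n i j → Edge G (c (toℕ i)) (c (toℕ j))
    cyclic i j (inj₁ eq) = forward i j eq
    cyclic i j (inj₂ (inj₁ eq)) = Edge-sym (forward j i eq)
    cyclic i j (inj₂ (inj₂ (inj₁ ends))) = closing i j ends
    cyclic i j (inj₂ (inj₂ (inj₂ ends))) = Edge-sym (closing j i ends)

  interleave⇒HamiltonianCycle : ∀ {m} → 3 ≤ n → n ≡ double m → (f g : ℕ → Fin n)
    → (∀ {i j} → i < m → j < m → f i ≡ f j → i ≡ j)
    → (∀ {i j} → i < m → j < m → g i ≡ g j → i ≡ j)
    → (∀ {i j} → i < m → j < m → f i ≢ g j)
    → (∀ {i} → i < m → Edge G (f i) (g i))
    → (∀ {i} → suc i < m → Edge G (g i) (f (suc i)))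
    → (∀ {i} → suc i ≡ m → Edge G (g i) (f 0))
    → HamiltonianCycle G
  interleave⇒HamiltonianCycle {m} n≥3 n≡2m f g f-injective g-injective f≢g fg gf close =
    sequence⇒HamiltonianCycle n≥3 c injective step closing
    where
    c : ℕ → Fin n
    c = interleave f g

    even≡ : ∀ i → c (double i) ≡ f i
    even≡ = interleave-even f g

    odd≡ : ∀ i → c (suc (double i)) ≡ g i
    odd≡ = interleave-odd f g

    even< : ∀ {i} → double i < n → i < m
    even< = double-cancel-< ∘ subst (_ <_) n≡2m

    odd< : ∀ {i} → suc (double i) < n → i < m
    odd< = suc-double-cancel-< ∘ subst (_ <_) n≡2m

    injective : ∀ {p q} → p < n → q < n → c p ≡ c q → p ≡ q
    injective {p} {q} p< q< eq with evenOdd p | evenOdd q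
    ... | even i | even j = cong double (f-injective (even< p<) (even< q<) (trans (sym (even≡ i)) (trans eq (even≡ j))))
    ... | odd i | odd j = cong (suc ∘ double) (g-injective (odd< p<) (odd< q<) (trans (sym (odd≡ i)) (trans eq (odd≡ j))))
    ... | even i | odd j = ⊥-elim (f≢g (even< p<) (odd< q<) (trans (sym (even≡ i)) (trans eq (odd≡ j))))
    ... | odd i | even j = ⊥-elim (f≢g (even< q<) (odd< p<) (trans (sym (even≡ j)) (trans (sym eq) (odd≡ i))))

    step : ∀ {p} → suc p < n → Edge G (c p) (c (suc p))
    step {p} p+1< with evenOdd p
    ... | even i = subst₂ (Edge G) (sym (even≡ i)) (sym (odd≡ i)) (fg (odd< p+1<))
    ... | odd i = subst₂ (Edge G) (sym (odd≡ i)) (sym (even≡ (suc i))) (gf (even< {suc i} p+1<))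

    closing′ : ∀ m′ → n ≡ double m′ → (∀ {i} → suc i ≡ m′ → Edge G (g i) (f 0))
      → ∀ {p} → suc p ≡ n → Edge G (c p) (c 0)
    closing′ (suc k) refl close′ last =
      subst (λ x → Edge G x (f 0)) (sym (trans (cong c (ℕ.suc-injective last)) (odd≡ k))) (close′ refl)

    closing : ∀ {p} → suc p ≡ n → Edge G (c p) (c 0)
    closing = closing′ m n≡2m close

  module OrderedSide {X : Subset n} (bipartition : IsBipartition G X) (p5-free : P5Free G)
                     (connected : ∀ u v → Reach G ⊥ u v) {m : ℕ} (ordering : DegreeOrdering X m) where

    open ChainStructure bipartition p5-free
    open DegreeOrdering ordering

    first-dominates : 0 < m → ∀ {w} → w ∉ X → Edge G (vertex 0) w
    first-dominates 0<m = maxDegree-dominates (vertex-∈ 0<m) maximal (connected (vertex 0))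
      where
      maximal : ∀ {u} → u ∈ X → degree u ≤ degree (vertex 0)
      maximal u∈X with vertex-surjective u∈X
      ... | i , i<m , refl = degree-antitone z≤n i<m

    later⊆earlier : ∀ {i j w} → i ≤ j → j < m → Edge G (vertex j) w → Edge G (vertex i) w
    later⊆earlier i≤j j<m = dominating⇒nested (vertex-∈ 0<m) (first-dominates 0<m)
      (vertex-∈ (ℕ.≤-<-trans i≤j j<m)) (vertex-∈ j<m) (degree-antitone i≤j j<m)
      where
      0<m : 0 < m
      0<m = ℕ.≤-<-trans z≤n j<m

  module BalancedTough {A : Subset n} (bipartition : IsBipartition G A) (p5-free : P5Free G)
           (connected : Connected G) (balanced : ∣ A ∣ ≡ ∣ ∁ A ∣)
           (tough : ∀ (S : Subset n) → Nonempty S → ∀ (k : ℕ) → NumComponents G S k → k ≤ ∣ S ∣) where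

    m : ℕ
    m = ∣ A ∣

    n≡2m : n ≡ double m
    n≡2m = trans (sym (ℕ.m+[n∸m]≡n (∣p∣≤n A)))
      (trans (cong (m +_) (trans (sym (∣∁p∣≡n∸∣p∣ A)) (sym balanced))) (sym (double≡+ m)))

    orderingA : DegreeOrdering A m
    orderingA = degreeOrdering (proj₁ connected) A

    orderingB : DegreeOrdering (∁ A) m
    orderingB = subst (DegreeOrdering (∁ A)) (sym balanced) (degreeOrdering (proj₁ connected) (∁ A))

    module α = DegreeOrdering orderingA
    module β = DegreeOrdering orderingB
    module A-side = OrderedSide bipartition p5-free (proj₂ connected) orderingA
    module B-side = OrderedSide (∁-IsBipartition bipartition) p5-free (proj₂ connected) orderingB
    open ChainStructure bipartition p5-free using (∈⇒adjacent∉)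

    α β : ℕ → Fin n
    α = α.vertex
    β = β.vertex

    β∉A : ∀ {i} → i < m → β i ∉ A
    β∉A = x∈∁p⇒x∉p ∘ β.vertex-∈

    module NonAdjacent {j t} (1≤j : 1 ≤ j) (1≤t : 1 ≤ t) (j+t≤m : j + t ≤ m) (¬αβ : ¬ Edge G (α j) (β t)) where

      S : Subset n
      S = image β t

      j<m : j < m
      j<m = ℕ.<-≤-trans (ℕ.m<m+n j 1≤t) j+t≤m

      t<m : t < m
      t<m = ℕ.<-≤-trans (ℕ.m<n+m t 1≤j) j+t≤m

      0<m : 0 < m
      0<m = ℕ.≤-<-trans z≤n j<m

      α∉S : ∀ {i} → i < m → α i ∉ S
      α∉S i<m α∈S with ∈-image⁻ β t α∈S
      ... | q , q<t , eq = β∉A (ℕ.<-≤-trans q<t (ℕ.<⇒≤ t<m)) (subst (_∈ A) (sym eq) (α.vertex-∈ i<m))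

      α-isolated : ∀ {r} → j ≤ r → r < m → Isolated S (α r)
      α-isolated {r} j≤r r<m w αw with β.vertex-surjective (x∉p⇒x∈∁p (∈⇒adjacent∉ (α.vertex-∈ r<m) αw))
      ... | q , q<m , refl with q ℕ.<? t
      ...   | yes q<t = ∈-image⁺ β q<t
      ...   | no q≮t = ⊥-elim (¬αβ (Edge-sym (B-side.later⊆earlier (ℕ.≮⇒≥ q≮t) q<m
                          (Edge-sym (A-side.later⊆earlier j≤r r<m αw)))))

      reaches-α₀ : ∀ {x w} → x ∉ S → w ∉ S → Edge G x w → Reach G S x (α 0)
      reaches-α₀ {x} {w} x∉S w∉S xw with x ∈? A
      ... | yes x∈A = there x∉S xw
                        (there w∉S (Edge-sym (A-side.first-dominates 0<m (∈⇒adjacent∉ x∈A xw))) (here (α∉S 0<m)))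
      ... | no x∉A = there x∉S (Edge-sym (A-side.first-dominates 0<m x∉A)) (here (α∉S 0<m))

      index< : (i : Fin t) → j + toℕ i < m
      index< i = ℕ.<-≤-trans (ℕ.+-monoʳ-< j (Fin.toℕ<n i)) j+t≤m

      family : Fin (suc t) → Outside S
      family fz = α 0 , α∉S 0<m
      family (fs i) = α (j + toℕ i) , α∉S (index< i)

      family-isolated : (i : Fin t) → Isolated S (α (j + toℕ i))
      family-isolated i = α-isolated (ℕ.m≤m+n j _) (index< i)

      offset≢0 : (i : Fin t) → j + toℕ i ≢ 0
      offset≢0 i = ≢-sym (ℕ.<⇒≢ (ℕ.≤-trans 1≤j (ℕ.m≤m+n j _)))

      separated : ∀ a b → Reach G S (proj₁ (family a)) (proj₁ (family b)) → a ≡ b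
      separated fz fz _ = refl
      separated fz (fs i) r =
        ⊥-elim (offset≢0 i (sym (α.vertex-injective 0<m (index< i) (Reach-Isolated (family-isolated i) r))))
      separated (fs i) fz r =
        ⊥-elim (offset≢0 i (α.vertex-injective (index< i) 0<m (Isolated-Reach (family-isolated i) r)))
      separated (fs i) (fs i') r = cong fs (Fin.toℕ-injective (ℕ.+-cancelˡ-≡ j _ _
        (α.vertex-injective (index< i) (index< i') (Isolated-Reach (family-isolated i) r))))

      too-many-components : suc t ≤ t
      too-many-components with numComponents-hub (α∉S 0<m) reaches-α₀
      ... | k , components = begin
        suc t  ≤⟨ numComponents-≥ components family separated ⟩
        k      ≤⟨ tough S (β 0 , ∈-image⁺ β 1≤t) k components ⟩
        ∣ S ∣  ≤⟨ ∣image∣≤ β t ⟩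
        t      ∎
        where open ℕ.≤-Reasoning

    α-β-adjacent : ∀ {j t} → j < m → t < m → j + t ≤ m → Edge G (α j) (β t)
    α-β-adjacent {zero} _ t<m _ = A-side.first-dominates (ℕ.≤-<-trans z≤n t<m) (β∉A t<m)
    α-β-adjacent {suc j} {zero} j<m _ _ =
      Edge-sym (B-side.first-dominates (ℕ.≤-<-trans z≤n j<m) (x∈p⇒x∉∁p (α.vertex-∈ j<m)))
    α-β-adjacent {suc j} {suc t} _ _ j+t≤m with Edge? (α (suc j)) (β (suc t))
    ... | yes αβ = αβ
    ... | no ¬αβ = ⊥-elim (ℕ.<-irrefl refl (NonAdjacent.too-many-components (s≤s z≤n) (s≤s z≤n) j+t≤m ¬αβ))

    hamiltonian : 3 ≤ n → HamiltonianCycle G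
    hamiltonian n≥3 =
      interleave⇒HamiltonianCycle n≥3 n≡2m α β′ α.vertex-injective β′-injective α≢β′ αβ′ β′α closing
      where
      β′ : ℕ → Fin n
      β′ i = β (m ∸ suc i)

      reverse< : ∀ {i} → i < m → m ∸ suc i < m
      reverse< i<m = ℕ.∸-monoʳ-< (s≤s z≤n) i<m

      β′-injective : ∀ {i j} → i < m → j < m → β′ i ≡ β′ j → i ≡ j
      β′-injective i<m j<m eq =
        ℕ.suc-injective (ℕ.∸-cancelˡ-≡ i<m j<m (β.vertex-injective (reverse< i<m) (reverse< j<m) eq))

      α≢β′ : ∀ {i j} → i < m → j < m → α i ≢ β′ j
      α≢β′ i<m j<m eq = β∉A (reverse< j<m) (subst (_∈ A) eq (α.vertex-∈ i<m))

      αβ′ : ∀ {i} → i < m → Edge G (α i) (β′ i)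
      αβ′ {i} i<m = α-β-adjacent i<m (reverse< i<m)
        (ℕ.≤-trans (ℕ.+-monoˡ-≤ _ (ℕ.n≤1+n i)) (ℕ.≤-reflexive (ℕ.m+[n∸m]≡n i<m)))

      β′α : ∀ {i} → suc i < m → Edge G (β′ i) (α (suc i))
      β′α {i} i+1<m = Edge-sym (α-β-adjacent i+1<m (reverse< (ℕ.<-trans (ℕ.n<1+n i) i+1<m))
        (ℕ.≤-reflexive (ℕ.m+[n∸m]≡n (ℕ.<⇒≤ i+1<m))))

      closing : ∀ {i} → suc i ≡ m → Edge G (β′ i) (α 0)
      closing {i} i+1≡m = subst (λ q → Edge G (β q) (α 0)) (sym (trans (cong (m ∸_) i+1≡m) (ℕ.n∸n≡0 m)))
        (Edge-sym (α-β-adjacent 0<m 0<m z≤n))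
        where
        0<m : 0 < m
        0<m = subst (0 <_) i+1≡m (s≤s z≤n)

theorem5 : (n : ℕ) → 3 ≤ n → (G : Graph n) → (A : Subset n)
    → Connected G → P5Free G → ChordalBipartite G
    → IsBipartition G A → ∣ A ∣ ≡ ∣ ∁ A ∣
    → (∀ (S : Subset n) → Nonempty S → ∀ (k : ℕ) → NumComponents G S k → k ≤ ∣ S ∣)
    → HamiltonianCycle G
theorem5 n n≥3 G A connected p5-free _ bipartition balanced tough =
  BalancedTough.hamiltonian G bipartition p5-free connected balanced tough n≥3
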